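{- (The Vertex-Cut Bound.) Let $\mathcal{C}\subseteq\mathbb{F}^I$ be a linear code, let $\mathcal{G}=(V,E)$ be a connected graph, and let $\Gamma=(\mathcal{G},\omega,(\mathcal{S}_e)_{e\in E},(C_v)_{v\in V})$ be a graphical realization of $\mathcal{C}$ on $\mathcal{G}$. If $(V_0,V_1,\ldots,V_\delta)$ (with $\delta\ge 0$) is a star partition of $V$, then, defining $J_i=\omega^{ -1}(V_i)$ for $i=1,\ldots,\delta$, $$\sum_{v\in V_0}\dim(C_v)\;\ge\;\dim(\mathcal{C})-\sum_{i=1}^{\delta}\dim(\mathcal{C}_{J_i}).$$
   Context: $\mathbb{F}$ is a finite field and $I$ a finite index set; a linear code on $I$ is a subspace $\mathcal{C}\subseteq\mathbb{F}^I$. For $\mathbf{x}\in\mathbb{F}^I$ and $J\subseteq I$, $\mathbf{x}|_J=(x_i)_{i\in J}$. The cross-section of $\mathcal{C}$ on $J$ is $\mathcal{C}_J=\{\mathbf{c}|_J:\mathbf{c}\in\mathcal{C},\ \mathbf{c}|_{I\setminus J}=\mathbf{0}\}$. Graphs are finite. For a graph $\mathcal{G}=(V,E)$ and $v\in V$, $E(v)$ is the set of edges incident with $v$. A graphical model is a tuple $(\mathcal{G},\omega,(\mathcal{S}_e)_{e\in E},(C_v)_{v\in V})$ where $\mathcal{G}=(V,E)$ is a connected graph, $\omega:I\to V$ is any map, each $\mathcal{S}_e$ is a finite-dimensional $\mathbb{F}$-vector space, and each $C_v$ is a subspace of $\mathbb{F}^{\omega^{ -1}(v)}\oplus\bigoplus_{e\in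 E(v)}\mathcal{S}_e$. Its full behavior $\mathfrak{B}$ is the set of all $\mathbf{b}=((x_i)_{i\in I},(\mathbf{s}_e)_{e\in E})\in\mathbb{F}^I\oplus\bigoplus_{e\in E}\mathcal{S}_e$ such that for every $v\in V$, $\mathbf{b}|_v:=((x_i)_{i\in\omega^{ -1}(v)},(\mathbf{s}_e)_{e\in E(v)})\in C_v$. The model is essential if $\{\mathbf{b}|_v:\mathbf{b}\in\mathfrak{B}\}=C_v$ for all $v$ and $\{\mathbf{s}_e:\mathbf{b}\in\mathfrak{B}\}=\mathcal{S}_e$ for all $e$. A graphical realization of $\mathcal{C}$ (on $\mathcal{G}$, extending $(\mathcal{G},\omega)$) is an essential graphical model whose full behavior satisfies $\{(x_i)_{i\in I}:\mathbf{b}\in\mathfrak{B}\}=\mathcal{C}$. For $W\subseteq V$, $N(W)$ is the set of vertices adjacent (in $\mathcal{G}$) to some vertex of $W$. An ordered collection $(V_0,V_1,\ldots,V_\delta)$, $\delta\ge0$, of subsets of $V$ is a star partition of $V$ if the $V_i$ are pairwise disjoint (some possibly empty), their union is $V$, and $N(V_i)\subseteq V_i\cup V_0$ for each $i\in\{1,\ldots,\delta\}$. -}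

module Defs where

open import Level using (0ℓ)
open import Algebra.Bundles using (CommutativeRing)
open import Data.Nat using (ℕ; zero; suc) renaming (_+_ to _+ℕ_)
open import Data.Fin using (Fin; zero; suc; _≟_)
open import Data.Bool using (Bool; true; false; _∨_; not; T; if_then_else_)
open import Data.Product using (Σ; ∃; _×_; _,_; proj₁; proj₂)
open import Data.Sum using (_⊎_; inj₁; inj₂)
open import Data.List using (List)
open import Data.List.Relation.Unary.Any using (Any)
open import Relation.Nullary using (¬_)
open import Relation.Nullary.Decidable using (⌊_⌋)
open import Relation.Binary.PropositionalEquality using (_≡_)
open import Function using (_∘_)

record FiniteField : Set₁ where
  field
    commRing : CommutativeRing 0ℓ 0ℓ
  open CommutativeRing commRing public
  field
    1≉0      : ¬ (1# ≈ 0#)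
    inverse  : ∀ x → ¬ (x ≈ 0#) → ∃ λ y → (x * y) ≈ 1#
    elements : List Carrier
    complete : ∀ x → Any (x ≈_) elements

sumFin : (n : ℕ) → (Fin n → ℕ) → ℕ
sumFin zero    f = 0
sumFin (suc n) f = f zero +ℕ sumFin n (f ∘ suc)

-- Finite graphs (multi-edges and loops allowed): vertices Fin nV,
-- edges Fin nE, each edge with its two endpoints.

record Graph : Set where
  field
    nV   : ℕ
    nE   : ℕ
    ends : Fin nE → Fin nV × Fin nV

  incident : Fin nE → Fin nV → Bool
  incident e v = ⌊ proj₁ (ends e) ≟ v ⌋ ∨ ⌊ proj₂ (ends e) ≟ v ⌋

  Adjacent : Fin nV → Fin nV → Set
  Adjacent u w = ∃ λ e → (ends e ≡ (u , w)) ⊎ (ends e ≡ (w , u))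

  data Reachable : Fin nV → Fin nV → Set where
    here : ∀ {v} → Reachable v v
    step : ∀ {u w x} → Adjacent u w → Reachable w x → Reachable u x

  Connected : Set
  Connected = ∀ u w → Reachable u w

  -- Star partition (V₀,V₁,…,V_δ) encoded by the block map
  -- part : V → {0,…,δ}, V_i = part⁻¹(i); blocks are automatically
  -- pairwise disjoint with union V (possibly empty).  The condition
  -- N(V_i) ⊆ V_i ∪ V₀ for i = suc j ∈ {1,…,δ}:
  IsStarPartition : (δ : ℕ) → (Fin nV → Fin (suc δ)) → Set
  IsStarPartition δ part =
    ∀ (j : Fin δ) u w → part u ≡ suc j → Adjacent u w →
      (part w ≡ suc j) ⊎ (part w ≡ zero)

module Over (𝔽 : FiniteField) where
  open FiniteField 𝔽 using (Carrier; _≈_; _+_; _*_; 0#; 1#)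

  Vect : Set → Set
  Vect K = K → Carrier

  _≋_ : {K : Set} → Vect K → Vect K → Set
  u ≋ v = ∀ k → u k ≈ v k

  0v : {K : Set} → Vect K
  0v k = 0#

  _+v_ : {K : Set} → Vect K → Vect K → Vect K
  (u +v v) k = u k + v k

  _·v_ : {K : Set} → Carrier → Vect K → Vect K
  (a ·v v) k = a * v k

  record IsSubspace {K : Set} (W : Vect K → Set) : Set where
    field
      resp  : ∀ {u v} → u ≋ v → W u → W v
      has0  : W 0v
      add   : ∀ {u v} → W u → W v → W (u +v v)
      scale : ∀ a {v} → W v → W (a ·v v)

  lincomb : {K : Set} {d : ℕ} → (Fin d → Vect K) → (Fin d → Carrier) → Vect K
  lincomb {d = zero}  vs a k = 0#
  lincomb {d = suc d} vs a k = (a zero * vs zero k) + lincomb (vs ∘ suc) (a ∘ suc) k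

  record IsBasis {K : Set} (W : Vect K → Set) (d : ℕ) (vs : Fin d → Vect K) : Set where
    field
      member      : ∀ j → W (vs j)
      independent : ∀ a → lincomb vs a ≋ 0v → ∀ j → a j ≈ 0#
      spanning    : ∀ w → W w → ∃ λ a → w ≋ lincomb vs a

  HasDim : {K : Set} → (Vect K → Set) → ℕ → Set
  HasDim {K} W d = ∃ λ (vs : Fin d → Vect K) → IsBasis W d vs

  -- index set I = Fin m; J ⊆ I given by its indicator
  Sub : {m : ℕ} → (Fin m → Bool) → Set
  Sub {m} J = Σ (Fin m) (λ i → T (J i))

  CrossSection : {m : ℕ} → (Vect (Fin m) → Set) → (J : Fin m → Bool) → Vect (Sub J) → Set
  CrossSection {m} 𝒞 J y =
    ∃ λ (c : Vect (Fin m)) → 𝒞 c × (∀ i → T (not (J i)) → c i ≈ 0#)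
                                 × (∀ (p : Sub J) → c (proj₁ p) ≈ y p)

  module _ (G : Graph) where
    open Graph G

    -- coordinates of the local space 𝔽^{ω⁻¹(v)} ⊕ ⨁_{e∈E(v)} S_e,
    -- with S_e = 𝔽^{sdim e}
    LocalCoord : {m : ℕ} → (Fin m → Fin nV) → (Fin nE → ℕ) → Fin nV → Set
    LocalCoord {m} ω sdim v =
      (Σ (Fin m) (λ i → T ⌊ ω i ≟ v ⌋))
      ⊎ (Σ (Fin nE) (λ e → T (incident e v) × Fin (sdim e)))

    record GraphicalModel (m : ℕ) : Set₁ where
      field
        ω     : Fin m → Fin nV
        sdim  : Fin nE → ℕ
        C     : (v : Fin nV) → Vect (LocalCoord ω sdim v) → Set
        C-sub : ∀ v → IsSubspace (C v)

      Config : Set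
      Config = Vect (Fin m) × ((e : Fin nE) → Vect (Fin (sdim e)))

      restrict : Config → (v : Fin nV) → Vect (LocalCoord ω sdim v)
      restrict (x , s) v (inj₁ (i , _))      = x i
      restrict (x , s) v (inj₂ (e , _ , j))  = s e j

      InBehavior : Config → Set
      InBehavior b = ∀ v → C v (restrict b v)

      Essential : Set
      Essential =
        (∀ v y → C v y → ∃ λ b → InBehavior b × (restrict b v ≋ y))
        × (∀ e (t : Vect (Fin (sdim e))) → ∃ λ b → InBehavior b × (proj₂ b e ≋ t))

      Realizes : (Vect (Fin m) → Set) → Set
      Realizes 𝒞 =
        Essential
        × (∀ x → 𝒞 x → ∃ λ b → InBehavior b × (x ≋ proj₁ b))
        × (∀ b → InBehavior b → 𝒞 (proj₁ b))

module Submission where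

open import Defs
open import Data.Nat as ℕ using (ℕ; _≤_; z≤n; s≤s; _≤?_)
import Data.Nat.Properties as ℕ
open import Data.Fin using (Fin; zero; suc; punchIn; _≟_; _↑ˡ_; _↑ʳ_; splitAt)
open import Data.Fin.Properties using (splitAt-↑ˡ; splitAt-↑ʳ; punchInᵢ≢i)
open import Data.Vec.Functional using (insertAt)
open import Data.Vec.Functional.Properties using (insertAt-lookup; insertAt-punchIn)
open import Data.Bool using (Bool; true; false; T; not; _∨_; if_then_else_)
open import Data.Bool.Properties using (T-∨)
open import Data.Product using (Σ; ∃; _×_; _,_; proj₁; proj₂)
open import Data.Sum using (_⊎_; inj₁; inj₂; [_,_])
open import Data.Unit using (tt)
open import Function using (_∘_; const)
open import Function.Bundles using (Equivalence)
open import Relation.Nullary using (¬_; yes; no)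
open import Relation.Nullary.Negation using (¬¬-map; contradiction)
open import Relation.Nullary.Decidable
  using (⌊_⌋; toWitness; fromWitness; decidable-stable; ¬¬-excluded-middle)
open import Relation.Binary.PropositionalEquality as ≡ using (_≡_)

-- Fix a basis c₁, …, cₙ of 𝒞 and lift each cₖ to a configuration Bₖ
-- of the full behaviour.  Expanding the local configurations Bₖ|ᵥ, v ∈ V₀, in
-- bases of the Cᵥ gives an n × D coordinate matrix t with D = Σ_{v∈V₀} dim Cᵥ.
-- If a row vector a annihilates t, then b = Σ aₖ Bₖ vanishes around every vertex
-- of V₀.  As no edge joins two different blocks Vⱼ (j ≥ 1), cutting b down to the
-- symbols of Vⱼ and the edges touching Vⱼ leaves a valid configuration, whose
-- symbols form a codeword of the cross-section 𝒞_{Jⱼ}; and the symbols of b are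
-- the sum of these cuts.  Hence Σ aₖ cₖ lies in the span of the d = Σⱼ dim 𝒞_{Jⱼ}
-- zero-extended basis vectors of the cross-sections, and the "kernel bound" of
-- linear algebra (Gaussian elimination on t) gives n ≤ D + d.

-- Indices into a concatenation of blocks of sizes f 0, …, f (n-1): split and
-- join identify Fin (sumFin n f) with Σ v. Fin (f v).  They flatten the
-- doubly indexed families (vertex, basis vector) into the single index the
-- kernel bound needs.
shift : ∀ {n} {f : Fin (ℕ.suc n) → ℕ} → Σ (Fin n) (Fin ∘ f ∘ suc) → Σ (Fin (ℕ.suc n)) (Fin ∘ f)
shift (v , l) = suc v , l

split : ∀ n (f : Fin n → ℕ) → Fin (sumFin n f) → Σ (Fin n) (Fin ∘ f)
split (ℕ.suc n) f r = [ (zero ,_) , shift ∘ split n (f ∘ suc) ] (splitAt (f zero) r)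

join : ∀ n (f : Fin n → ℕ) → Σ (Fin n) (Fin ∘ f) → Fin (sumFin n f)
join (ℕ.suc n) f (zero  , l) = l ↑ˡ sumFin n (f ∘ suc)
join (ℕ.suc n) f (suc v , l) = f zero ↑ʳ join n (f ∘ suc) (v , l)

-- every (block, position) pair is hit, so conditions on all flat indices
-- reach every pair
split-join : ∀ n (f : Fin n → ℕ) p → split n f (join n f p) ≡ p
split-join (ℕ.suc n) f (zero , l)
  rewrite splitAt-↑ˡ (f zero) l (sumFin n (f ∘ suc)) = ≡.refl
split-join (ℕ.suc n) f (suc v , l)
  rewrite splitAt-↑ʳ (f zero) (sumFin n (f ∘ suc)) (join n (f ∘ suc) (v , l))
        | split-join n (f ∘ suc) (v , l) = ≡.refl

module Edges (G : Graph) where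
  open Graph G

  EndOf : Fin nE → Fin nV → Set
  EndOf e u = proj₁ (ends e) ≡ u ⊎ proj₂ (ends e) ≡ u

  hasEndIn : (Fin nV → Bool) → Fin nE → Bool
  hasEndIn S e = S (proj₁ (ends e)) ∨ S (proj₂ (ends e))

  hasEndIn-end : ∀ S e → T (hasEndIn S e) → ∃ λ u → EndOf e u × T (S u)
  hasEndIn-end S e e∈S with Equivalence.to T-∨ e∈S
  ... | inj₁ first∈S  = _ , inj₁ ≡.refl , first∈S
  ... | inj₂ second∈S = _ , inj₂ ≡.refl , second∈S

  end-hasEndIn : ∀ S e {u} → EndOf e u → T (S u) → T (hasEndIn S e)
  end-hasEndIn S e (inj₁ ≡.refl) u∈S = Equivalence.from T-∨ (inj₁ u∈S)
  end-hasEndIn S e (inj₂ ≡.refl) u∈S = Equivalence.from T-∨ (inj₂ u∈S)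

  incident-end : ∀ {e v} → T (incident e v) → EndOf e v
  incident-end {e} {v} inc with hasEndIn-end (λ u → ⌊ u ≟ v ⌋) e inc
  ... | u , e-u , u≟v = ≡.subst (EndOf e) (toWitness u≟v) e-u

  ends-adjacent : ∀ {e u w} → EndOf e u → EndOf e w → u ≡ w ⊎ Adjacent u w
  ends-adjacent         (inj₁ ≡.refl) (inj₁ ≡.refl) = inj₁ ≡.refl
  ends-adjacent {e = e} (inj₁ ≡.refl) (inj₂ ≡.refl) = inj₂ (e , inj₁ ≡.refl)
  ends-adjacent {e = e} (inj₂ ≡.refl) (inj₁ ≡.refl) = inj₂ (e , inj₂ ≡.refl)
  ends-adjacent         (inj₂ ≡.refl) (inj₂ ≡.refl) = inj₁ ≡.refl

  star-edge : ∀ {δ part} → IsStarPartition δ part → ∀ j e {u v} →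
              EndOf e u → part u ≡ suc j → EndOf e v → part v ≡ suc j ⊎ part v ≡ zero
  star-edge star j e e-u u∈Vj e-v with ends-adjacent e-u e-v
  ... | inj₁ ≡.refl = inj₁ u∈Vj
  ... | inj₂ u~v    = star j _ _ u∈Vj u~v

module LinearAlgebra (𝔽 : FiniteField) where
  open FiniteField 𝔽 hiding (zero)
  open Over 𝔽
  open import Algebra.Properties.Semiring.Sum semiring public using (sum-syntax; sum-cong-≋)
  open import Algebra.Properties.Semiring.Sum semiring
    using (sum-cong-≗; sum-remove; ∑-comm; *-distribˡ-sum; *-distribʳ-sum; sum-replicate-zero)
  open import Relation.Binary.Reasoning.Setoid setoid

  ∑-zero : ∀ {n} {f : Fin n → Carrier} → (∀ j → f j ≈ 0#) → ∑[ j < n ] f j ≈ 0#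
  ∑-zero {n} z = trans (sum-cong-≋ z) (sum-replicate-zero n)

  ∑-single : ∀ {n} (q : Fin (ℕ.suc n)) (f : Fin (ℕ.suc n) → Carrier) →
             (∀ j → f (punchIn q j) ≈ 0#) → ∑[ i < ℕ.suc n ] f i ≈ f q
  ∑-single q f off = begin
    ∑[ i < _ ] f i                      ≈⟨ sum-remove {i = q} f ⟩
    f q + ∑[ j < _ ] f (punchIn q j)    ≈⟨ +-congˡ (∑-zero off) ⟩
    f q + 0#                            ≈⟨ +-identityʳ (f q) ⟩
    f q                                 ∎

  ∑-++ : ∀ a b (h : Fin (a ℕ.+ b) → Carrier) →
         ∑[ r < a ℕ.+ b ] h r ≈ ∑[ i < a ] h (i ↑ˡ b) + ∑[ i < b ] h (a ↑ʳ i)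
  ∑-++ ℕ.zero    b h = sym (+-identityˡ _)
  ∑-++ (ℕ.suc a) b h = trans (+-congˡ (∑-++ a b (h ∘ suc))) (sym (+-assoc _ _ _))

  ∑-split : ∀ n (f : Fin n → ℕ) (g : Σ (Fin n) (Fin ∘ f) → Carrier) →
            ∑[ r < sumFin n f ] g (split n f r) ≈ ∑[ v < n ] ∑[ l < f v ] g (v , l)
  ∑-split ℕ.zero    f g = refl
  ∑-split (ℕ.suc n) f g = begin
    ∑[ r < sumFin (ℕ.suc n) f ] g (split (ℕ.suc n) f r)
      ≈⟨ ∑-++ (f zero) S (g ∘ split (ℕ.suc n) f) ⟩
    ∑[ l < f zero ] g (split (ℕ.suc n) f (l ↑ˡ S)) + ∑[ r < S ] g (split (ℕ.suc n) f (f zero ↑ʳ r))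
      ≡⟨ ≡.cong₂ _+_ (sum-cong-≗ (λ l → ≡.cong (g ∘ choose) (splitAt-↑ˡ (f zero) l S)))
                     (sum-cong-≗ (λ r → ≡.cong (g ∘ choose) (splitAt-↑ʳ (f zero) S r))) ⟩
    ∑[ l < f zero ] g (zero , l) + ∑[ r < S ] g (shift (split n (f ∘ suc) r))
      ≈⟨ +-congˡ (∑-split n (f ∘ suc) (g ∘ shift)) ⟩
    ∑[ v < ℕ.suc n ] ∑[ l < f v ] g (v , l)  ∎
    where
      S = sumFin n (f ∘ suc)
      choose : Fin (f zero) ⊎ Fin S → Σ (Fin (ℕ.suc n)) (Fin ∘ f)
      choose = [ (zero ,_) , shift ∘ split n (f ∘ suc) ]

  combination : ∀ {X : Set} {n} → (Fin n → Vect X) → (Fin n → Carrier) → Vect X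
  combination {n = n} v a x = ∑[ j < n ] (a j * v j x)

  Independent : ∀ {X : Set} {n} → (Fin n → Vect X) → Set
  Independent v = ∀ a → combination v a ≋ 0v → ∀ j → a j ≈ 0#

  InSpan : ∀ {X : Set} {d} → (Fin d → Vect X) → Vect X → Set
  InSpan y u = ∃ λ β → u ≋ combination y β

  InSpan-resp : ∀ {X : Set} {d} (y : Fin d → Vect X) {u w : Vect X} → u ≋ w → InSpan y u → InSpan y w
  InSpan-resp y u≋w (β , u≋yβ) = β , λ x → trans (sym (u≋w x)) (u≋yβ x)

  lincomb-combination : ∀ {X : Set} {d} (v : Fin d → Vect X) (a : Fin d → Carrier) →
                        lincomb v a ≋ combination v a
  lincomb-combination {d = ℕ.zero}  v a x = refl
  lincomb-combination {d = ℕ.suc d} v a x = +-congˡ (lincomb-combination (v ∘ suc) (a ∘ suc) x)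

  basis-independent : ∀ {X : Set} {W : Vect X → Set} {d v} → IsBasis W d v → Independent v
  basis-independent basis a av≈0 =
    IsBasis.independent basis a (λ x → trans (lincomb-combination _ a x) (av≈0 x))

  basis-spans : ∀ {X : Set} {W : Vect X → Set} {d v} → IsBasis W d v → ∀ {w} → W w → InSpan v w
  basis-spans basis {w} w∈W with IsBasis.spanning basis w w∈W
  ... | β , w≈vβ = β , λ x → trans (w≈vβ x) (lincomb-combination _ β x)

  record ExpansionIf {X : Set} {n} (b : Bool) (d : ℕ) (w : Fin n → Vect X) : Set where
    field
      family       : Fin d → Vect X
      coefficients : Fin n → Fin d → Carrier
      expands      : T b → ∀ k → w k ≋ combination family (coefficients k)

  expansion-if : ∀ {X : Set} {W : Vect X → Set} {d n} (b : Bool) → (T b → HasDim W d) →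
                 (w : Fin n → Vect X) → (∀ k → W (w k)) → ExpansionIf b (if b then d else 0) w
  expansion-if true dim w w∈W = record
    { family       = proj₁ (dim tt)
    ; coefficients = λ k → proj₁ (coordinates k)
    ; expands      = λ _ k → proj₂ (coordinates k) }
    where
      coordinates : ∀ k → InSpan (proj₁ (dim tt)) (w k)
      coordinates k = basis-spans (proj₂ (dim tt)) (w∈W k)
  expansion-if false dim w w∈W = record { family = λ () ; coefficients = λ k () ; expands = λ () }

  subspace-combination : ∀ {X : Set} {W : Vect X → Set} → IsSubspace W →
                         ∀ {n} (v : Fin n → Vect X) a → (∀ k → W (v k)) → W (combination v a)
  subspace-combination sub {ℕ.zero}  v a v∈W = IsSubspace.has0 sub
  subspace-combination sub {ℕ.suc n} v a v∈W =
    IsSubspace.add sub (IsSubspace.scale sub (a zero) (v∈W zero))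
                       (subspace-combination sub (v ∘ suc) (a ∘ suc) (v∈W ∘ suc))

  combination-zero : ∀ {X : Set} {d} (y : Fin d → Vect X) {β} → (∀ l → β l ≈ 0#) →
                     combination y β ≋ 0v
  combination-zero y β≈0 x = ∑-zero (λ l → trans (*-congʳ (β≈0 l)) (zeroˡ (y l x)))

  combination-combination : ∀ {X : Set} {n d} (y : Fin d → Vect X) (α : Fin n → Fin d → Carrier) a →
    combination (λ k → combination y (α k)) a ≋ combination y (λ l → ∑[ k < n ] (a k * α k l))
  combination-combination {n = n} {d} y α a x = begin
    ∑[ k < n ] (a k * ∑[ l < d ] (α k l * y l x))
      ≈⟨ sum-cong-≋ (λ k → *-distribˡ-sum (a k) (λ l → α k l * y l x)) ⟩
    ∑[ k < n ] ∑[ l < d ] (a k * (α k l * y l x))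
      ≈⟨ ∑-comm (λ k l → a k * (α k l * y l x)) ⟩
    ∑[ l < d ] ∑[ k < n ] (a k * (α k l * y l x))
      ≈⟨ sum-cong-≋ (λ l → sum-cong-≋ (λ k → sym (*-assoc (a k) (α k l) (y l x)))) ⟩
    ∑[ l < d ] ∑[ k < n ] ((a k * α k l) * y l x)
      ≈⟨ sum-cong-≋ (λ l → sym (*-distribʳ-sum (y l x) (λ k → a k * α k l))) ⟩
    ∑[ l < d ] (∑[ k < n ] (a k * α k l) * y l x)    ∎

  unit : ∀ {n} → Fin n → Fin n → Carrier
  unit {ℕ.suc n} k = insertAt (const 0#) k 1#

  combination-unit : ∀ {X : Set} {n} (v : Fin n → Vect X) k → combination v (unit k) ≋ v k
  combination-unit {n = ℕ.suc n} v k x = begin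
    combination v (unit k) x
      ≈⟨ ∑-single k (λ i → unit k i * v i x)
           (λ j → trans (*-congʳ (reflexive (insertAt-punchIn (const 0#) k 1# j))) (zeroˡ _)) ⟩
    unit k k * v k x           ≡⟨ ≡.cong (_* v k x) (insertAt-lookup _ k 1#) ⟩
    1# * v k x                 ≈⟨ *-identityˡ (v k x) ⟩
    v k x                      ∎

module RankBounds (𝔽 : FiniteField) where
  open FiniteField 𝔽 hiding (zero)
  open Over 𝔽
  open LinearAlgebra 𝔽
  open import Algebra.Properties.Semiring.Sum semiring
    using (sum-cong-≗; sum-remove; ∑-distrib-+; *-distribʳ-sum)
  open import Algebra.Properties.Ring ring using (-‿distribˡ-*; -‿distribʳ-*)
  open import Relation.Binary.Reasoning.Setoid setoid

  eliminate : ∀ {n} (k : Fin (ℕ.suc n)) (μ : Fin n → Carrier) →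
              (Fin (ℕ.suc n) → Carrier) → Fin n → Carrier
  eliminate k μ w j = w (punchIn k j) - μ j * w k

  -- Coefficients on the original rows reproducing a combination of the eliminated rows.
  lift : ∀ {n} (k : Fin (ℕ.suc n)) (μ : Fin n → Carrier) → (Fin n → Carrier) → Fin (ℕ.suc n) → Carrier
  lift {n} k μ a′ = insertAt a′ k (- ∑[ j < n ] (a′ j * μ j))

  -- The key identity of elimination: combining the eliminated rows with a′ is
  -- combining the original rows with lift a′, the pivot row entering with total
  -- weight -Σⱼ a′ⱼ μⱼ.  (Rows are scalars here; apply it coordinatewise.)
  eliminate-lift : ∀ {n} (k : Fin (ℕ.suc n)) (μ a′ : Fin n → Carrier) (w : Fin (ℕ.suc n) → Carrier) →
    ∑[ i < ℕ.suc n ] (lift k μ a′ i * w i) ≈ ∑[ j < n ] (a′ j * eliminate k μ w j)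
  eliminate-lift {n} k μ a′ w = begin
    ∑[ i < ℕ.suc n ] (lift k μ a′ i * w i)
      ≈⟨ sum-remove {i = k} (λ i → lift k μ a′ i * w i) ⟩
    lift k μ a′ k * w k + ∑[ j < n ] (lift k μ a′ (punchIn k j) * w (punchIn k j))
      ≡⟨ ≡.cong₂ _+_ (≡.cong (_* w k) (insertAt-lookup a′ k (- S)))
                     (sum-cong-≗ (λ j → ≡.cong (_* w (punchIn k j)) (insertAt-punchIn a′ k (- S) j))) ⟩
    - S * w k + A
      ≈⟨ trans (+-comm _ A) (+-congˡ (trans (sym (-‿distribˡ-* S (w k))) (-‿distribʳ-* S (w k)))) ⟩
    A + S * (- w k)
      ≈⟨ +-congˡ (*-distribʳ-sum (- w k) (λ j → a′ j * μ j)) ⟩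
    A + ∑[ j < n ] ((a′ j * μ j) * (- w k))
      ≈⟨ sym (∑-distrib-+ (λ j → a′ j * w (punchIn k j)) (λ j → (a′ j * μ j) * (- w k))) ⟩
    ∑[ j < n ] (a′ j * w (punchIn k j) + (a′ j * μ j) * (- w k))
      ≈⟨ sum-cong-≋ (λ j → distribute (a′ j) (w (punchIn k j)) (μ j) (w k)) ⟩
    ∑[ j < n ] (a′ j * eliminate k μ w j)    ∎
    where
      S = ∑[ j < n ] (a′ j * μ j)
      A = ∑[ j < n ] (a′ j * w (punchIn k j))
      distribute : ∀ a u m v → a * u + (a * m) * (- v) ≈ a * (u - m * v)
      distribute a u m v = sym (trans (distribˡ a u (- (m * v)))
        (+-congˡ (trans (*-congˡ (-‿distribʳ-* m v)) (sym (*-assoc a m (- v))))))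

  LeftKernel : ∀ {n D} → (Fin n → Fin D → Carrier) → (Fin n → Carrier) → Set
  LeftKernel {n} t a = ∀ r → ∑[ k < n ] (a k * t k r) ≈ 0#

  zero-or-nonzero-entry : ∀ {n} (f : Fin n → Carrier) →
                          ¬ ¬ ((∀ j → f j ≈ 0#) ⊎ ∃ λ j → ¬ f j ≈ 0#)
  zero-or-nonzero-entry {ℕ.zero}  f k = k (inj₁ λ ())
  zero-or-nonzero-entry {ℕ.suc n} f k = ¬¬-excluded-middle λ
    { (no f₀≉0)  → k (inj₂ (zero , f₀≉0))
    ; (yes f₀≈0) → zero-or-nonzero-entry (f ∘ suc) λ
        { (inj₁ rest≈0)         → k (inj₁ λ { zero → f₀≈0 ; (suc j) → rest≈0 j })
        ; (inj₂ (j , fⱼ≉0)) → k (inj₂ (suc j , fⱼ≉0)) } }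

  -- Induction on D: a zero column is dropped, otherwise a pivot in the first
  -- column eliminates one row and that column.
  module KernelBound {X : Set} (P : Vect X → Set) (P-resp : ∀ {u w} → u ≋ w → P u → P w)
                     (K : ℕ) (P-bound : ∀ {n} (c : Fin n → Vect X) → Independent c →
                                        (∀ a → P (combination c a)) → n ≤ K) where

    Controlled : ∀ {n D} → (Fin n → Vect X) → (Fin n → Fin D → Carrier) → Set
    Controlled c t = ∀ a → LeftKernel t a → P (combination c a)

    drop-zero-column : ∀ {n D} (c : Fin n → Vect X) (t : Fin n → Fin (ℕ.suc D) → Carrier) →
                       (∀ k → t k zero ≈ 0#) → Controlled c t → Controlled c (λ k r → t k (suc r))
    drop-zero-column c t column≈0 controlled a ker = controlled a λ
      { zero    → ∑-zero (λ k → trans (*-congˡ (column≈0 k)) (zeroʳ (a k)))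
      ; (suc r) → ker r }

    module Pivot {n D} (c : Fin (ℕ.suc n) → Vect X) (t : Fin (ℕ.suc n) → Fin (ℕ.suc D) → Carrier)
                 (k : Fin (ℕ.suc n)) (ι : Carrier) (t-k-ι : t k zero * ι ≈ 1#) where

      μ : Fin n → Carrier
      μ j = t (punchIn k j) zero * ι

      c′ : Fin n → Vect X
      c′ j x = eliminate k μ (λ i → c i x) j

      t′ : Fin n → Fin D → Carrier
      t′ j r = eliminate k μ (λ i → t i (suc r)) j

      pivot-column-cleared : ∀ j → eliminate k μ (λ i → t i zero) j ≈ 0#
      pivot-column-cleared j = begin
        t (punchIn k j) zero - (t (punchIn k j) zero * ι) * t k zero
          ≈⟨ +-congˡ (-‿cong (trans (*-assoc _ ι _) (*-congˡ (trans (*-comm ι _) t-k-ι)))) ⟩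
        t (punchIn k j) zero - t (punchIn k j) zero * 1#
          ≈⟨ +-congˡ (-‿cong (*-identityʳ _)) ⟩
        t (punchIn k j) zero - t (punchIn k j) zero
          ≈⟨ -‿inverseʳ _ ⟩
        0#  ∎

      independent′ : Independent c → Independent c′
      independent′ independent a′ c′a′≈0 j = begin
        a′ j                       ≡⟨ insertAt-punchIn a′ k _ j ⟨
        lift k μ a′ (punchIn k j)  ≈⟨ independent (lift k μ a′)
                                        (λ x → trans (eliminate-lift k μ a′ (λ i → c i x)) (c′a′≈0 x))
                                        (punchIn k j) ⟩
        0#                         ∎

      controlled′ : Controlled c t → Controlled c′ t′
      controlled′ controlled a′ ker′ =
        P-resp (λ x → eliminate-lift k μ a′ (λ i → c i x)) (controlled (lift k μ a′) ker)
        where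
          ker : LeftKernel t (lift k μ a′)
          ker zero    = trans (eliminate-lift k μ a′ (λ i → t i zero))
                              (∑-zero (λ j → trans (*-congˡ (pivot-column-cleared j)) (zeroʳ (a′ j))))
          ker (suc r) = trans (eliminate-lift k μ a′ (λ i → t i (suc r))) (ker′ r)

    -- Since equality in 𝔽 is not decidable, the case distinction on the first
    -- column is made under double negation; the conclusion is decidable.
    kernel-bound : ∀ D {n} (c : Fin n → Vect X) (t : Fin n → Fin D → Carrier) →
                   Independent c → Controlled c t → n ≤ D ℕ.+ K
    kernel-bound ℕ.zero    c t independent controlled =
      P-bound c independent (λ a → controlled a (λ ()))
    kernel-bound (ℕ.suc D) {ℕ.zero}  c t independent controlled = z≤n
    kernel-bound (ℕ.suc D) {ℕ.suc n} c t independent controlled =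
      decidable-stable (ℕ.suc n ≤? ℕ.suc D ℕ.+ K)
        (¬¬-map reduce (zero-or-nonzero-entry (λ k → t k zero)))
      where
        reduce : (∀ k → t k zero ≈ 0#) ⊎ (∃ λ k → ¬ t k zero ≈ 0#) → ℕ.suc n ≤ ℕ.suc D ℕ.+ K
        reduce (inj₁ column≈0) =
          ℕ.m≤n⇒m≤1+n (kernel-bound D c (λ k r → t k (suc r)) independent
                                    (drop-zero-column c t column≈0 controlled))
        reduce (inj₂ (k , pivot≉0)) with inverse (t k zero) pivot≉0
        ... | ι , t-k-ι = s≤s (kernel-bound D c′ t′ (independent′ independent) (controlled′ controlled))
          where open Pivot c t k ι t-k-ι

  null-family-bound : ∀ {X : Set} {n} (c : Fin n → Vect X) → Independent c →
                      (∀ a → combination c a ≋ 0v) → n ≤ 0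
  null-family-bound {n = ℕ.zero}  c independent null = z≤n
  null-family-bound {n = ℕ.suc n} c independent null =
    contradiction (independent (const 1#) (null (const 1#)) zero) 1≉0

  -- An independent family all of whose combinations lie in the span of d vectors
  -- has at most d members: expand each cₖ in y and apply the kernel bound with P = zero.
  span-bound : ∀ {X : Set} {d n} (y : Fin d → Vect X) (c : Fin n → Vect X) → Independent c →
               (∀ a → InSpan y (combination c a)) → n ≤ d
  span-bound {X} {d} {n} y c independent spanned =
    ≡.subst (n ≤_) (ℕ.+-identityʳ d) (kernel-bound d c β independent controlled)
    where
      open KernelBound (_≋ 0v) (λ u≋w u≈0 x → trans (sym (u≋w x)) (u≈0 x)) 0 null-family-bound
      β : Fin n → Fin d → Carrier
      β k = proj₁ (spanned (unit k))
      c≈yβ : ∀ k → c k ≋ combination y (β k)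
      c≈yβ k x = trans (sym (combination-unit c k x)) (proj₂ (spanned (unit k)) x)
      controlled : Controlled c β
      controlled a aβ≈0 x = begin
        combination c a x                                     ≈⟨ sum-cong-≋ (λ k → *-congˡ (c≈yβ k x)) ⟩
        combination (λ k → combination y (β k)) a x           ≈⟨ combination-combination y β a x ⟩
        combination y (λ l → ∑[ k < n ] (a k * β k l)) x      ≈⟨ combination-zero y aβ≈0 x ⟩
        0#                                                    ∎

  kernel-span-bound : ∀ {X : Set} {D d n} (t : Fin n → Fin D → Carrier) (y : Fin d → Vect X)
                      (c : Fin n → Vect X) → Independent c →
                      (∀ a → LeftKernel t a → InSpan y (combination c a)) → n ≤ D ℕ.+ d
  kernel-span-bound {D = D} {d} t y c =
    KernelBound.kernel-bound (InSpan y) (InSpan-resp y) d (span-bound y) D c t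

module ZeroExtension (𝔽 : FiniteField) where
  open FiniteField 𝔽 hiding (zero)
  open Over 𝔽
  open LinearAlgebra 𝔽
  open import Relation.Binary.Reasoning.Setoid setoid

  onlyIf : (b : Bool) → (T b → Carrier) → Carrier
  onlyIf true  f = f tt
  onlyIf false f = 0#

  onlyIf-holds : ∀ b (f : T b → Carrier) (p : T b) → onlyIf b f ≡ f p
  onlyIf-holds true f p = ≡.refl

  onlyIf-zero : ∀ b {f : T b → Carrier} → (∀ p → f p ≈ 0#) → onlyIf b f ≈ 0#
  onlyIf-zero true  f≈0 = f≈0 tt
  onlyIf-zero false f≈0 = refl

  onlyIf-outside : ∀ b (f : T b → Carrier) → T (not b) → onlyIf b f ≈ 0#
  onlyIf-outside false f _ = refl

  onlyIf-cong : ∀ b {f g : T b → Carrier} → (∀ p → f p ≈ g p) → onlyIf b f ≈ onlyIf b g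
  onlyIf-cong true  f≈g = f≈g tt
  onlyIf-cong false f≈g = refl

  onlyIf-combination : ∀ b {d} (h : Fin d → T b → Carrier) (β : Fin d → Carrier) →
    onlyIf b (λ p → ∑[ l < d ] (β l * h l p)) ≈ ∑[ l < d ] (β l * onlyIf b (h l))
  onlyIf-combination true  h β = refl
  onlyIf-combination false h β = sym (∑-zero (λ l → zeroʳ (β l)))

  ∑-nonzero-block : ∀ {δ} (q : Fin (ℕ.suc δ)) (X : Carrier) → (q ≡ zero → X ≈ 0#) →
                    X ≈ ∑[ i < δ ] onlyIf ⌊ q ≟ suc i ⌋ (const X)
  ∑-nonzero-block {δ} q X q≡0⇒X≈0 = begin
    X                                               ≡⟨ onlyIf-holds ⌊ q ≟ q ⌋ (const X) (fromWitness ≡.refl) ⟨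
    onlyIf ⌊ q ≟ q ⌋ (const X)                      ≈⟨ ∑-single q (λ i → onlyIf ⌊ q ≟ i ⌋ (const X)) off-q ⟨
    ∑[ i < ℕ.suc δ ] onlyIf ⌊ q ≟ i ⌋ (const X)
      ≈⟨ +-congʳ (onlyIf-zero ⌊ q ≟ zero ⌋ (q≡0⇒X≈0 ∘ toWitness)) ⟩
    0# + ∑[ i < δ ] onlyIf ⌊ q ≟ suc i ⌋ (const X)  ≈⟨ +-identityˡ _ ⟩
    ∑[ i < δ ] onlyIf ⌊ q ≟ suc i ⌋ (const X)       ∎
    where
      off-q : ∀ j → onlyIf ⌊ q ≟ punchIn q j ⌋ (const X) ≈ 0#
      off-q j = onlyIf-zero ⌊ q ≟ punchIn q j ⌋ λ q≟j →
                  contradiction (≡.sym (toWitness q≟j)) (punchInᵢ≢i q j)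

  extend : ∀ {m} (J : Fin m → Bool) → Vect (Sub J) → Vect (Fin m)
  extend J u i = onlyIf (J i) (λ p → u (i , p))

  extend-cong : ∀ {m} (J : Fin m → Bool) {u w} → u ≋ w → extend J u ≋ extend J w
  extend-cong J u≋w i = onlyIf-cong (J i) (λ p → u≋w (i , p))

  extend-combination : ∀ {m d} (J : Fin m → Bool) (h : Fin d → Vect (Sub J)) β →
                       extend J (combination h β) ≋ combination (extend J ∘ h) β
  extend-combination J h β i = onlyIf-combination (J i) (λ l p → h l (i , p)) β

module Configurations (𝔽 : FiniteField) (G : Graph) {m} (Γ : Over.GraphicalModel 𝔽 G m) where
  open FiniteField 𝔽 hiding (zero)
  open Over 𝔽
  open LinearAlgebra 𝔽
  open ZeroExtension 𝔽
  open Graph G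
  open GraphicalModel Γ
  open Edges G

  configCombination : ∀ {n} → (Fin n → Config) → (Fin n → Carrier) → Config
  configCombination B a = combination (proj₁ ∘ B) a , λ e → combination (λ k → proj₂ (B k) e) a

  restrict-combination : ∀ {n} (B : Fin n → Config) a v →
                         restrict (configCombination B a) v ≋ combination (λ k → restrict (B k) v) a
  restrict-combination B a v (inj₁ _) = refl
  restrict-combination B a v (inj₂ _) = refl

  behavior-combination : ∀ {n} (B : Fin n → Config) a → (∀ k → InBehavior (B k)) →
                         InBehavior (configCombination B a)
  behavior-combination B a B∈𝔅 v =
    IsSubspace.resp (C-sub v) (λ q → sym (restrict-combination B a v q))
      (subspace-combination (C-sub v) (λ k → restrict (B k) v) a (λ k → B∈𝔅 k v))

  -- Cutting along a star partition (V₀, V₁, …, V_δ), given by the block map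
  -- part; blocks V_{j+1}, j : Fin δ, are the points of the star.
  module Cut (δ : ℕ) (part : Fin nV → Fin (ℕ.suc δ)) (star : IsStarPartition δ part) where

    VanishesOnV₀ : Config → Set
    VanishesOnV₀ b = ∀ v → part v ≡ zero → restrict b v ≋ 0v

    inBlock : Fin δ → Fin nV → Bool
    inBlock j u = ⌊ part u ≟ suc j ⌋

    J : Fin δ → Fin m → Bool
    J j = inBlock j ∘ ω

    cut : Fin δ → Config → Config
    cut j b = extend (J j) (proj₁ b ∘ proj₁)
            , λ e l → onlyIf (hasEndIn (inBlock j) e) (const (proj₂ b e l))

    -- Inside V_{j+1} the cut agrees with the configuration ...
    cut-inside : ∀ j b v → part v ≡ suc j → restrict b v ≋ restrict (cut j b) v
    cut-inside j b v v∈Vj (inj₁ (i , ωi≟v)) =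
      reflexive (≡.sym (onlyIf-holds (J j i) _ (fromWitness (≡.trans (≡.cong part (toWitness ωi≟v)) v∈Vj))))
    cut-inside j b v v∈Vj (inj₂ (e , inc , l)) =
      reflexive (≡.sym (onlyIf-holds (hasEndIn (inBlock j) e) _
                          (end-hasEndIn (inBlock j) e (incident-end inc) (fromWitness v∈Vj))))

    -- ... and outside V_{j+1} it vanishes: by the star property an edge touching
    -- V_{j+1} at a vertex v outside V_{j+1} has v ∈ V₀, where b vanishes.
    cut-outside : ∀ j b v → VanishesOnV₀ b → ¬ part v ≡ suc j → restrict (cut j b) v ≋ 0v
    cut-outside j b v b↾V₀≈0 v∉Vj (inj₁ (i , ωi≟v)) =
      onlyIf-zero (J j i) λ ωi∈Vj →
        contradiction (≡.trans (≡.cong part (≡.sym (toWitness ωi≟v))) (toWitness ωi∈Vj)) v∉Vj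
    cut-outside j b v b↾V₀≈0 v∉Vj (inj₂ (e , inc , l)) =
      onlyIf-zero (hasEndIn (inBlock j) e) λ touches →
        let u , e-u , u∈Vj = hasEndIn-end (inBlock j) e touches in
        [ (λ v∈Vj → contradiction v∈Vj v∉Vj) , (λ v∈V₀ → b↾V₀≈0 v v∈V₀ (inj₂ (e , inc , l))) ]
          (star-edge star j e e-u (toWitness u∈Vj) (incident-end inc))

    cut-behavior : ∀ j b → InBehavior b → VanishesOnV₀ b → InBehavior (cut j b)
    cut-behavior j b b∈𝔅 b↾V₀≈0 v with part v ≟ suc j
    ... | yes v∈Vj = IsSubspace.resp (C-sub v) (cut-inside j b v v∈Vj) (b∈𝔅 v)
    ... | no  v∉Vj = IsSubspace.resp (C-sub v) (λ q → sym (cut-outside j b v b↾V₀≈0 v∉Vj q))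
                                      (IsSubspace.has0 (C-sub v))

    cut-sum : ∀ b → VanishesOnV₀ b → proj₁ b ≋ (λ i → ∑[ j < δ ] proj₁ (cut j b) i)
    cut-sum b b↾V₀≈0 i = ∑-nonzero-block (part (ω i)) (proj₁ b i)
                           (λ ωi∈V₀ → b↾V₀≈0 (ω i) ωi∈V₀ (inj₁ (i , fromWitness ≡.refl)))

module VertexCut (𝔽 : FiniteField) {m} (𝒞 : Over.Vect 𝔽 (Fin m) → Set) (G : Graph)
                 (Γ : Over.GraphicalModel 𝔽 G m) (realizes : Over.GraphicalModel.Realizes Γ 𝒞)
                 (δ : ℕ) (part : Fin (Graph.nV G) → Fin (ℕ.suc δ))
                 (star : Graph.IsStarPartition G δ part) where
  open FiniteField 𝔽 hiding (zero)
  open Over 𝔽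
  open LinearAlgebra 𝔽
  open ZeroExtension 𝔽
  open RankBounds 𝔽 using (LeftKernel)
  open Graph G
  open GraphicalModel Γ
  open Configurations 𝔽 G Γ
  open Cut δ part star
  open import Relation.Binary.Reasoning.Setoid setoid

  cut-cross-section : ∀ j b → InBehavior b → VanishesOnV₀ b → CrossSection 𝒞 (J j) (proj₁ b ∘ proj₁)
  cut-cross-section j b b∈𝔅 b↾V₀≈0 =
    proj₁ (cut j b) , proj₂ (proj₂ realizes) (cut j b) (cut-behavior j b b∈𝔅 b↾V₀≈0)
    , (λ i i∉J → onlyIf-outside (J j i) _ i∉J)
    , (λ { (i , i∈J) → reflexive (onlyIf-holds (J j i) _ i∈J) })

  module CrossSectionBases {dimJ : Fin δ → ℕ} (hJ : ∀ j → HasDim (CrossSection 𝒞 (J j)) (dimJ j)) where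

    blockGenerator : Σ (Fin δ) (Fin ∘ dimJ) → Vect (Fin m)
    blockGenerator (j , l) = extend (J j) (proj₁ (hJ j) l)

    generator : Fin (sumFin δ dimJ) → Vect (Fin m)
    generator = blockGenerator ∘ split δ dimJ

    -- Symbols of a V₀-vanishing configuration are spanned by the generators:
    -- they are the sum of the cuts, each of which expands in its cross-section basis.
    symbols-in-span : ∀ b → InBehavior b → VanishesOnV₀ b → InSpan generator (proj₁ b)
    symbols-in-span b b∈𝔅 b↾V₀≈0 = coefficient ∘ split δ dimJ , λ i → begin
      proj₁ b i                                                   ≈⟨ cut-sum b b↾V₀≈0 i ⟩
      ∑[ j < δ ] proj₁ (cut j b) i                                ≈⟨ sum-cong-≋ (λ j → cut-expansion j i) ⟩
      ∑[ j < δ ] ∑[ l < dimJ j ] (coefficient (j , l) * blockGenerator (j , l) i)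
        ≈⟨ ∑-split δ dimJ (λ p → coefficient p * blockGenerator p i) ⟨
      combination generator (coefficient ∘ split δ dimJ) i        ∎
      where
        expansion : ∀ j → InSpan (proj₁ (hJ j)) (proj₁ b ∘ proj₁)
        expansion j = basis-spans (proj₂ (hJ j)) (cut-cross-section j b b∈𝔅 b↾V₀≈0)
        coefficient : Σ (Fin δ) (Fin ∘ dimJ) → Carrier
        coefficient (j , l) = proj₁ (expansion j) l
        cut-expansion : ∀ j →
          proj₁ (cut j b) ≋ combination (extend (J j) ∘ proj₁ (hJ j)) (proj₁ (expansion j))
        cut-expansion j i = trans (extend-cong (J j) (proj₂ (expansion j)) i)
                                  (extend-combination (J j) (proj₁ (hJ j)) (proj₁ (expansion j)) i)

  module LiftedBasis {n} (c : Fin n → Vect (Fin m)) (c∈𝒞 : ∀ k → 𝒞 (c k))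
                     {dimC : Fin nV → ℕ} (hC : ∀ v → part v ≡ zero → HasDim (C v) (dimC v)) where

    lifted : ∀ k → ∃ λ b → InBehavior b × (c k ≋ proj₁ b)
    lifted k = proj₁ (proj₂ realizes) (c k) (c∈𝒞 k)

    B : Fin n → Config
    B k = proj₁ (lifted k)

    B∈𝔅 : ∀ k → InBehavior (B k)
    B∈𝔅 k = proj₁ (proj₂ (lifted k))

    symbols-combination : ∀ a → combination c a ≋ proj₁ (configCombination B a)
    symbols-combination a i = sum-cong-≋ (λ k → *-congˡ (proj₂ (proj₂ (lifted k)) i))

    localDim : Fin nV → ℕ
    localDim v = if ⌊ part v ≟ zero ⌋ then dimC v else 0

    local : ∀ v → ExpansionIf ⌊ part v ≟ zero ⌋ (localDim v) (λ k → restrict (B k) v)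
    local v = expansion-if ⌊ part v ≟ zero ⌋ (hC v ∘ toWitness)
                (λ k → restrict (B k) v) (λ k → B∈𝔅 k v)

    localCoordinate : Fin n → Σ (Fin nV) (Fin ∘ localDim) → Carrier
    localCoordinate k (v , l) = ExpansionIf.coefficients (local v) k l

    coordinates : Fin n → Fin (sumFin nV localDim) → Carrier
    coordinates k = localCoordinate k ∘ split nV localDim

    kernel-vanishes : ∀ a → LeftKernel coordinates a → VanishesOnV₀ (configCombination B a)
    kernel-vanishes a ker v v∈V₀ q = begin
      restrict (configCombination B a) v q             ≈⟨ restrict-combination B a v q ⟩
      combination (λ k → restrict (B k) v) a q
        ≈⟨ sum-cong-≋ (λ k → *-congˡ (expands (fromWitness v∈V₀) k q)) ⟩
      combination (λ k → combination family (coefficients k)) a q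
        ≈⟨ combination-combination family coefficients a q ⟩
      combination family (λ l → ∑[ k < n ] (a k * coefficients k l)) q
        ≈⟨ combination-zero family column-vanishes q ⟩
      0#  ∎
      where
        open ExpansionIf (local v)
        column-vanishes : ∀ l → ∑[ k < n ] (a k * coefficients k l) ≈ 0#
        column-vanishes l = ≡.subst (λ p → ∑[ k < n ] (a k * localCoordinate k p) ≈ 0#)
                                    (split-join nV localDim (v , l)) (ker (join nV localDim (v , l)))

open import Data.Nat using (_+_)

theorem4p3 : (𝔽 : FiniteField) (m : ℕ) (𝒞 : Over.Vect 𝔽 (Fin m) → Set) →
    Over.IsSubspace 𝔽 𝒞 →
    (G : Graph) → Graph.Connected G →
    (Γ : Over.GraphicalModel 𝔽 G m) →
    Over.GraphicalModel.Realizes Γ 𝒞 →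
    (δ : ℕ) (part : Fin (Graph.nV G) → Fin (ℕ.suc δ)) →
    Graph.IsStarPartition G δ part →
    (dimCode : ℕ) → Over.HasDim 𝔽 𝒞 dimCode →
    (dimC : Fin (Graph.nV G) → ℕ) →
    (∀ v → part v ≡ zero → Over.HasDim 𝔽 (Over.GraphicalModel.C Γ v) (dimC v)) →
    (dimJ : Fin δ → ℕ) →
    (∀ j → Over.HasDim 𝔽
             (Over.CrossSection 𝔽 𝒞
               (λ i → ⌊ part (Over.GraphicalModel.ω Γ i) ≟ suc j ⌋))
             (dimJ j)) →
    dimCode ≤ sumFin (Graph.nV G) (λ v → if ⌊ part v ≟ zero ⌋ then dimC v else 0)
              + sumFin δ dimJ
theorem4p3 𝔽 _ 𝒞 _ G _ Γ realizes δ part star _ (c , c-basis) dimC hC dimJ hJ =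
  kernel-span-bound coordinates generator c (basis-independent c-basis) λ a a∈ker →
    InSpan-resp generator (λ i → FiniteField.sym 𝔽 (symbols-combination a i))
      (symbols-in-span (configCombination B a) (behavior-combination B a B∈𝔅)
                       (kernel-vanishes a a∈ker))
  where
    open Over 𝔽 using (module IsBasis)
    open LinearAlgebra 𝔽
    open RankBounds 𝔽 using (kernel-span-bound)
    open Configurations 𝔽 G Γ
    open VertexCut 𝔽 𝒞 G Γ realizes δ part star
    open CrossSectionBases hJ
    open LiftedBasis c (IsBasis.member c-basis) hC
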